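{- Let $\mathcal{R}$ be the Rado graph with vertex set $V$ and let $\mathcal{H}$ be the hypergraph on $V$ whose edges are the subsets of $V$ inducing a subgraph isomorphic to $\mathcal{R}$. Then the subgroup of $\mathrm{Sym}(V)$ generated by $\mathrm{Aut}(\mathcal{H}) \cup \mathrm{FSym}(V)$ is contained in $\mathrm{FAut}(\mathcal{H})$.
   Context: The Rado graph $\mathcal{R}$ is the unique (up to isomorphism) countable graph such that for all finite disjoint sets of vertices $A, B$ there is a vertex adjacent to every vertex of $A$ and to no vertex of $B$. $\mathrm{FSym}(V)$ is the group of finitary permutations of $V$. $\mathrm{Aut}(\mathcal{H})$ is the group of permutations $g$ of $V$ such that $E$ is an edge iff $Eg$ is an edge. $\mathrm{FAut}(\mathcal{H})$ is the set of permutations $g$ of $V$ for which there is a finite $S \subseteq V$ such that for every edge $E$ of $\mathcal{H}$, both $(E\setminus S)g$ and $(E\setminus S)g^{ -1}$ are edges of $\mathcal{H}$ (this is a group). -}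

module Defs where

open import Data.Nat using (ℕ)
open import Data.Bool using (Bool; true; false; _∧_; not)
open import Data.List using (List)
open import Data.List.Membership.Propositional using (_∈_; _∉_)
open import Data.List.Membership.DecPropositional (Data.Nat._≟_) using (_∈?_)
open import Data.Product using (Σ; ∃; _×_; proj₁)
open import Function.Bundles using (_↔_; Inverse)
open import Relation.Binary.PropositionalEquality using (_≡_)
open import Relation.Nullary.Decidable using (⌊_⌋)
open import Data.Sum using (_⊎_)
open import Function.Construct.Composition using (_↔-∘_)
open import Function.Construct.Symmetry using (↔-sym)
open import Function.Construct.Identity using (↔-id)

-- Vertex set V = ℕ (the Rado graph is countably infinite).
-- A (simple) graph on ℕ: a Boolean adjacency relation.
Graph : Set
Graph = ℕ → ℕ → Bool

record IsRado (adj : Graph) : Set where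
  field
    symmetric   : ∀ x y → adj x y ≡ adj y x
    irreflexive : ∀ x → adj x x ≡ false
    extension   : (A B : List ℕ) → (∀ a → a ∈ A → a ∉ B) →
                  ∃ λ z → (∀ a → a ∈ A → adj z a ≡ true)
                        × (∀ b → b ∈ B → adj z b ≡ false)

Subset : Set
Subset = ℕ → Bool

Elem : Subset → Set
Elem E = Σ ℕ λ v → E v ≡ true

InducesRado : Graph → Subset → Set
InducesRado adj E =
  Σ (Elem E ↔ ℕ) λ f →
    ∀ x y → adj (proj₁ x) (proj₁ y) ≡ adj (Inverse.to f x) (Inverse.to f y)

IsEdge : Graph → Subset → Set
IsEdge adj E = InducesRado adj E

Perm : Set
Perm = ℕ ↔ ℕ

-- Image Eg = { e g | e ∈ E } (g acts on the right, g applied via `to`).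
image : Perm → Subset → Subset
image g E y = E (Inverse.from g y)

inv : Perm → Perm
inv = ↔-sym

-- Composition, right action: x (g · h) = (x g) h.
_·_ : Perm → Perm → Perm
g · h = h ↔-∘ g

idPerm : Perm
idPerm = ↔-id ℕ

_≈ₚ_ : Perm → Perm → Set
g ≈ₚ h = ∀ x → Inverse.to g x ≡ Inverse.to h x

IsAutH : Graph → Perm → Set
IsAutH adj g = ∀ E → (IsEdge adj E → IsEdge adj (image g E))
                   × (IsEdge adj (image g E) → IsEdge adj E)

IsFinitary : Perm → Set
IsFinitary g = ∃ λ (L : List ℕ) → ∀ v → v ∉ L → Inverse.to g v ≡ v

_∖_ : Subset → List ℕ → Subset
(E ∖ S) v = E v ∧ not ⌊ v ∈? S ⌋

IsFAutH : Graph → Perm → Set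
IsFAutH adj g = ∃ λ (S : List ℕ) → ∀ E → IsEdge adj E →
  IsEdge adj (image g (E ∖ S)) × IsEdge adj (image (inv g) (E ∖ S))

data Generated (X : Perm → Set) : Perm → Set where
  gen  : ∀ {g} → X g → Generated X g
  one  : Generated X idPerm
  mul  : ∀ {g h} → Generated X g → Generated X h → Generated X (g · h)
  inv' : ∀ {g} → Generated X g → Generated X (inv g)
  ext  : ∀ {g h} → Generated X g → g ≈ₚ h → Generated X h

AutOrFSym : Graph → Perm → Set
AutOrFSym adj g = IsAutH adj g ⊎ IsFinitary g

-- The edges of H are exactly the sets F ⊆ V with the extension property of R relativised
-- to F: an edge inherits it from R through its isomorphism, and conversely a back-and-forth
-- argument builds an isomorphism between any two such sets, in particular between F and V.
-- The property survives removing a finite set S from F, since the extension vertex can be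
-- kept out of S: first pick w ∈ F adjacent to all of S ∩ F, then also demand non-adjacency
-- to w.  So the edges are closed under finite removals, and for any hypergraph with that
-- closure property the permutations g admitting a finite S such that (E ∖ S)g and (E ∖ S)g⁻¹
-- are edges for every edge E form a group: S = ∅ serves automorphisms, the support serves
-- finitary permutations, and g·h is served by S ∪ Tg⁻¹ (and the analogue for (g·h)⁻¹).
module Submission where

open import Defs
open import Axiom.UniquenessOfIdentityProofs using (module Decidable⇒UIP)
open import Data.Bool using (Bool; true; false)
open import Data.Bool.Properties using (∧-zeroʳ; ∧-identityʳ) renaming (_≟_ to _≟ᵇ_)
open import Data.List using (List; []; _∷_; _++_; map; filter)
open import Data.List.Membership.Propositional using (_∈_; _∉_; mapWith∈)
open import Data.List.Membership.Propositional.Properties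
  using (∈-map⁺; ∈-map⁻; ∈-++⁺ˡ; ∈-++⁺ʳ; ∈-++⁻; ∈-filter⁺; ∈-filter⁻)
open import Data.List.Relation.Unary.Any using (here; there)
open import Data.List.Relation.Unary.Any.Properties using (mapWith∈⁺; mapWith∈⁻)
open import Data.Nat using (ℕ; zero; suc; _+_; _≟_; _≤′_; ≤′-refl; ≤′-step)
open import Data.Nat.Properties using (m≤′m+n; n≤′m+n)
open import Data.List.Membership.DecPropositional _≟_ using (_∈?_)
open import Data.Product using (Σ; ∃; _×_; _,_; proj₁; proj₂; map₂; swap)
open import Data.Sum using (inj₁; inj₂; [_,_]′)
open import Function using (_∘_; id)
open import Function.Bundles using (_↔_; Inverse; Injection; mk↔ₛ′)
open import Function.Construct.Composition using (_↔-∘_)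
open import Function.Properties.Inverse using (↔⇒↣)
open import Relation.Nullary using (yes; no; contradiction)
open import Relation.Nullary.Decidable using (toSum)
open import Relation.Binary.PropositionalEquality

_≐_ : Subset → Subset → Set
E ≐ F = ∀ v → E v ≡ F v

Elem-≡ : ∀ {E} {x y : Elem E} → proj₁ x ≡ proj₁ y → x ≡ y
Elem-≡ {x = v , p} {.v , q} refl = cong (v ,_) (Decidable⇒UIP.≡-irrelevant _≟ᵇ_ p q)

Elem-cong : ∀ {E F} → E ≐ F → Elem E ↔ Elem F
Elem-cong E≐F = mk↔ₛ′ (λ x → proj₁ x , trans (sym (E≐F _)) (proj₂ x))
                      (λ y → proj₁ y , trans (E≐F _) (proj₂ y))
                      (λ _ → Elem-≡ refl) (λ _ → Elem-≡ refl)

full : Subset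
full _ = true

Elem-full : Elem full ↔ ℕ
Elem-full = mk↔ₛ′ proj₁ (_, refl) (λ _ → refl) (λ _ → Elem-≡ refl)

module _ {E : Subset} {S : List ℕ} {v : ℕ} where

  ∖-∈ : v ∈ S → (E ∖ S) v ≡ false
  ∖-∈ v∈S with v ∈? S
  ... | yes _    = ∧-zeroʳ (E v)
  ... | no  v∉S = contradiction v∈S v∉S

  ∖-∉ : v ∉ S → (E ∖ S) v ≡ E v
  ∖-∉ v∉S with v ∈? S
  ... | yes v∈S = contradiction v∈S v∉S
  ... | no  _    = ∧-identityʳ (E v)

  ∈-∖⁻ : (E ∖ S) v ≡ true → E v ≡ true × v ∉ S
  ∈-∖⁻ Ev = trans (sym (∖-∉ v∉S)) Ev , v∉S
    where
    v∉S : v ∉ S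
    v∉S v∈S with () ← trans (sym Ev) (∖-∈ v∈S)

∖-absorb : ∀ {E S} → (∀ {v} → v ∈ S → E v ≡ false) → (E ∖ S) ≐ E
∖-absorb {E} {S} S∩E=∅ v =
  [ (λ v∈S → trans (∖-∈ {E} v∈S) (sym (S∩E=∅ v∈S))) , ∖-∉ {E} ]′ (toSum (v ∈? S))

IsEdge-resp-≐ : ∀ {adj E F} → E ≐ F → IsEdge adj E → IsEdge adj F
IsEdge-resp-≐ E≐F (f , f-adj) = f ↔-∘ Elem-cong (sym ∘ E≐F) , λ x y → f-adj _ _

_⊆ₛ_ : List ℕ → Subset → Set
A ⊆ₛ F = ∀ {v} → v ∈ A → F v ≡ true

⊆ₛ-++ : ∀ {A B F} → A ⊆ₛ F → B ⊆ₛ F → (A ++ B) ⊆ₛ F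
⊆ₛ-++ {A} A⊆F B⊆F = [ A⊆F , B⊆F ]′ ∘ ∈-++⁻ A

filter-⊆ₛ : ∀ F L → filter (λ v → F v ≟ᵇ true) L ⊆ₛ F
filter-⊆ₛ F L = proj₂ ∘ ∈-filter⁻ (λ v → F v ≟ᵇ true) {xs = L}

Separates : Graph → ℕ → List ℕ → List ℕ → Set
Separates adj z A B = (∀ a → a ∈ A → adj z a ≡ true) × (∀ b → b ∈ B → adj z b ≡ false)

HasExtension : Graph → Subset → Set
HasExtension adj F = (A B : List ℕ) → A ⊆ₛ F → B ⊆ₛ F → (∀ a → a ∈ A → a ∉ B) →
                     ∃ λ z → F z ≡ true × Separates adj z A B

rado-extension : ∀ {adj} → IsRado adj → HasExtension adj full
rado-extension R A B _ _ A#B = map₂ (refl ,_) (IsRado.extension R A B A#B)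

module _ {E : Subset} (f : Elem E ↔ ℕ) where
  open Inverse f

  images : (D : List ℕ) → D ⊆ₛ E → List ℕ
  images D D⊆E = mapWith∈ D (λ {d} d∈D → to (d , D⊆E d∈D))

  ∈-images : ∀ {D} (D⊆E : D ⊆ₛ E) {d} (d∈D : d ∈ D) → to (d , D⊆E d∈D) ∈ images D D⊆E
  ∈-images _ d∈D = mapWith∈⁺ _ (_ , d∈D , refl)

  images-disjoint : ∀ {A B} (A⊆E : A ⊆ₛ E) (B⊆E : B ⊆ₛ E) → (∀ a → a ∈ A → a ∉ B) →
                    ∀ y → y ∈ images A A⊆E → y ∉ images B B⊆E
  images-disjoint {A} {B} _ _ A#B y y∈A′ y∈B′ with mapWith∈⁻ A _ y∈A′ | mapWith∈⁻ B _ y∈B′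
  ... | a , a∈A , refl | b , b∈B , ta≡tb =
    A#B a a∈A (subst (_∈ B) (sym (cong proj₁ (Injection.injective (↔⇒↣ f) ta≡tb))) b∈B)

edge-extension : ∀ {adj E} → HasExtension adj full → IsEdge adj E → HasExtension adj E
edge-extension {adj} {E} extℕ (f , f-adj) A B A⊆E B⊆E A#B
  with extℕ (images f A A⊆E) (images f B B⊆E) (λ _ → refl) (λ _ → refl)
           (images-disjoint f A⊆E B⊆E A#B)
... | z′ , _ , z′A , z′B =
  proj₁ (from z′) , proj₂ (from z′) ,
  (λ a a∈A → trans (pulled-back (A⊆E a∈A)) (z′A _ (∈-images f A⊆E a∈A))) ,
  (λ b b∈B → trans (pulled-back (B⊆E b∈B)) (z′B _ (∈-images f B⊆E b∈B)))
  where
  open Inverse f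
  pulled-back : ∀ {v} (Ev : E v ≡ true) → adj (proj₁ (from z′)) v ≡ adj z′ (to (v , Ev))
  pulled-back Ev = trans (f-adj (from z′) (_ , Ev)) (cong (λ u → adj u _) (strictlyInverseˡ z′))

Pairs : Set
Pairs = List (ℕ × ℕ)

_⊆ₚ_ : Pairs → Pairs → Set
p ⊆ₚ q = ∀ {e} → e ∈ p → e ∈ q

converse : Pairs → Pairs
converse = map swap

∈-converse⁺ : ∀ {p a b} → (a , b) ∈ p → (b , a) ∈ converse p
∈-converse⁺ = ∈-map⁺ swap

∈-converse⁻ : ∀ {p a b} → (b , a) ∈ converse p → (a , b) ∈ p
∈-converse⁻ m with ∈-map⁻ swap m
... | _ , m′ , refl = m′

∈-dom⁻ : ∀ {x} {p : Pairs} → x ∈ map proj₁ p → ∃ λ b → (x , b) ∈ p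
∈-dom⁻ m with ∈-map⁻ proj₁ m
... | (_ , b) , m′ , refl = b , m′

module SimpleGraph (adj : Graph) (symmetric : ∀ x y → adj x y ≡ adj y x)
                   (irreflexive : ∀ x → adj x x ≡ false) where

  loopless : ∀ {v} → adj v v ≢ true
  loopless {v} vv with () ← trans (sym (irreflexive v)) vv

  common-neighbour : ∀ {F} → HasExtension adj F → (L : List ℕ) → L ⊆ₛ F →
                     ∃ λ w → F w ≡ true × w ∉ L × (∀ v → v ∈ L → adj w v ≡ true)
  common-neighbour extF L L⊆F with extF L [] L⊆F (λ ()) (λ _ _ ())
  ... | w , Fw , w-adj , _ = w , Fw , (λ w∈L → loopless (w-adj w w∈L)) , w-adj

  extension-avoiding : ∀ {F} → HasExtension adj F → (L A B : List ℕ) → A ⊆ₛ F → B ⊆ₛ F →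
                       (∀ a → a ∈ A → a ∉ B) →
                       ∃ λ z → F z ≡ true × z ∉ L × Separates adj z A B
  extension-avoiding {F} extF L A B A⊆F B⊆F A#B
    with common-neighbour extF (A ++ B ++ filter (λ v → F v ≟ᵇ true) L)
                          (⊆ₛ-++ A⊆F (⊆ₛ-++ B⊆F (filter-⊆ₛ F L)))
  ... | w , Fw , w∉L′ , w-adj
    with extF A (w ∷ B) A⊆F (λ { (here refl) → Fw ; (there b∈B) → B⊆F b∈B }) A#wB
    where
    A#wB : ∀ a → a ∈ A → a ∉ w ∷ B
    A#wB a a∈A (here refl) = w∉L′ (∈-++⁺ˡ a∈A)
    A#wB a a∈A (there a∈B) = A#B a a∈A a∈B
  ... | z , Fz , zA , zB = z , Fz , z∉L , zA , (λ b → zB b ∘ there)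
    where
    z∉L : z ∉ L
    z∉L z∈L with () ← trans (sym (zB w (here refl)))
      (trans (symmetric z w) (w-adj z (∈-++⁺ʳ A (∈-++⁺ʳ B (∈-filter⁺ _ z∈L Fz)))))

  extension-∖ : ∀ {F} → HasExtension adj F → ∀ S → HasExtension adj (F ∖ S)
  extension-∖ {F} extF S A B A⊆F∖S B⊆F∖S A#B =
    let z , Fz , z∉S , z-sep = extension-avoiding extF S A B (proj₁ ∘ ∈-∖⁻ {F} ∘ A⊆F∖S)
                                                  (proj₁ ∘ ∈-∖⁻ {F} ∘ B⊆F∖S) A#B
    in z , trans (∖-∉ {F} z∉S) Fz , z-sep

  record PartialIso (F G : Subset) (p : Pairs) : Set where
    field
      dom⊆ : ∀ {a b} → (a , b) ∈ p → F a ≡ true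
      ran⊆ : ∀ {a b} → (a , b) ∈ p → G b ≡ true
      preserves-adj : ∀ {a b a′ b′} → (a , b) ∈ p → (a′ , b′) ∈ p → adj a a′ ≡ adj b b′
      functional : ∀ {a b a′ b′} → (a , b) ∈ p → (a′ , b′) ∈ p → a ≡ a′ → b ≡ b′
      injective : ∀ {a b a′ b′} → (a , b) ∈ p → (a′ , b′) ∈ p → b ≡ b′ → a ≡ a′
  open PartialIso

  PartialIso-[] : ∀ {F G} → PartialIso F G []
  PartialIso-[] = record
    { dom⊆ = λ () ; ran⊆ = λ () ; preserves-adj = λ () ; functional = λ () ; injective = λ () }

  PartialIso-converse : ∀ {F G p} → PartialIso F G p → PartialIso G F (converse p)
  PartialIso-converse i = record
    { dom⊆ = ran⊆ i ∘ ∈-converse⁻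
    ; ran⊆ = dom⊆ i ∘ ∈-converse⁻
    ; preserves-adj = λ m m′ → sym (preserves-adj i (∈-converse⁻ m) (∈-converse⁻ m′))
    ; functional = λ m m′ → injective i (∈-converse⁻ m) (∈-converse⁻ m′)
    ; injective = λ m m′ → functional i (∈-converse⁻ m) (∈-converse⁻ m′)
    }

  neighbourhood-image : ℕ → Bool → Pairs → List ℕ
  neighbourhood-image x β p = map proj₂ (filter (λ e → adj x (proj₁ e) ≟ᵇ β) p)

  module _ {x : ℕ} {β : Bool} {p : Pairs} where

    ∈-neighbourhood-image⁺ : ∀ {a b} → (a , b) ∈ p → adj x a ≡ β → b ∈ neighbourhood-image x β p
    ∈-neighbourhood-image⁺ m xa = ∈-map⁺ proj₂ (∈-filter⁺ (λ e → adj x (proj₁ e) ≟ᵇ β) m xa)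

    ∈-neighbourhood-image⁻ : ∀ {b} → b ∈ neighbourhood-image x β p →
                             ∃ λ a → (a , b) ∈ p × adj x a ≡ β
    ∈-neighbourhood-image⁻ m with ∈-map⁻ proj₂ m
    ... | (a , _) , m′ , refl = a , ∈-filter⁻ (λ e → adj x (proj₁ e) ≟ᵇ β) m′

  extend : ∀ {F G p x} → HasExtension adj G → PartialIso F G p → F x ≡ true →
           x ∉ map proj₁ p → ∃ λ z → PartialIso F G ((x , z) ∷ p)
  extend {F} {G} {p} {x} extG i Fx x∉dom =
    new-pair (extension-avoiding extG (map proj₂ p) (nbh true) (nbh false) (nbh⊆G true) (nbh⊆G false) split)
    where
    nbh : Bool → List ℕ
    nbh β = neighbourhood-image x β p
    nbh⊆G : ∀ β → nbh β ⊆ₛ G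
    nbh⊆G β m = ran⊆ i (proj₁ (proj₂ (∈-neighbourhood-image⁻ m)))
    split : ∀ b → b ∈ nbh true → b ∉ nbh false
    split b m m′ with ∈-neighbourhood-image⁻ m | ∈-neighbourhood-image⁻ m′
    ... | a , ab , xa | a′ , a′b , xa′
      with () ← trans (sym xa) (trans (cong (adj x) (injective i ab a′b refl)) xa′)
    new-pair : (∃ λ z → G z ≡ true × z ∉ map proj₂ p × Separates adj z (nbh true) (nbh false)) →
               ∃ λ z → PartialIso F G ((x , z) ∷ p)
    new-pair (z , Gz , z∉ran , zA , zB) = z , i′
      where
      mirrors : ∀ {a b} → (a , b) ∈ p → adj z b ≡ adj x a
      mirrors {a} {b} m with adj x a in xa
      ... | true  = zA b (∈-neighbourhood-image⁺ m xa)
      ... | false = zB b (∈-neighbourhood-image⁺ m xa)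
      i′ : PartialIso F G ((x , z) ∷ p)
      dom⊆ i′ (here refl) = Fx
      dom⊆ i′ (there m) = dom⊆ i m
      ran⊆ i′ (here refl) = Gz
      ran⊆ i′ (there m) = ran⊆ i m
      preserves-adj i′ (here refl) (here refl) = trans (irreflexive x) (sym (irreflexive z))
      preserves-adj i′ (here refl) (there m′) = sym (mirrors m′)
      preserves-adj i′ (there m) (here refl) =
        trans (symmetric _ x) (trans (sym (mirrors m)) (symmetric z _))
      preserves-adj i′ (there m) (there m′) = preserves-adj i m m′
      functional i′ (here refl) (here refl) _ = refl
      functional i′ (here refl) (there m′) refl = contradiction (∈-map⁺ proj₁ m′) x∉dom
      functional i′ (there m) (here refl) refl = contradiction (∈-map⁺ proj₁ m) x∉dom
      functional i′ (there m) (there m′) = functional i m m′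
      injective i′ (here refl) (here refl) _ = refl
      injective i′ (here refl) (there m′) refl = contradiction (∈-map⁺ proj₂ m′) z∉ran
      injective i′ (there m) (here refl) refl = contradiction (∈-map⁺ proj₂ m) z∉ran
      injective i′ (there m) (there m′) = injective i m m′

  forth : ∀ {F G p} → HasExtension adj G → PartialIso F G p → (x : ℕ) →
          ∃ λ q → PartialIso F G q × p ⊆ₚ q × (F x ≡ true → ∃ λ b → (x , b) ∈ q)
  forth {F} {p = p} extG i x with F x in Fx | x ∈? map proj₁ p
  ... | false | _         = p , i , id , λ ()
  ... | true  | yes x∈dom = p , i , id , λ _ → ∈-dom⁻ x∈dom
  ... | true  | no  x∉dom =
    let z , i′ = extend extG i Fx x∉dom in (x , z) ∷ p , i′ , there , λ _ → z , here refl

  record Refinement (F G : Subset) (p : Pairs) (n : ℕ) : Set where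
    field
      refined : Pairs
      refined-iso : PartialIso F G refined
      ⊆-refined : p ⊆ₚ refined
      dom-covers : F n ≡ true → ∃ λ b → (n , b) ∈ refined
      ran-covers : G n ≡ true → ∃ λ a → (a , n) ∈ refined
  open Refinement

  refine : ∀ {F G p} → HasExtension adj F → HasExtension adj G → PartialIso F G p →
           ∀ n → Refinement F G p n
  refine extF extG i n with forth extG i n
  ... | q , iq , p⊆q , n∈dom with forth extF (PartialIso-converse iq) n
  ...   | r , ir , q˘⊆r , n∈ran = record
    { refined = converse r
    ; refined-iso = PartialIso-converse ir
    ; ⊆-refined = ∈-converse⁺ ∘ q˘⊆r ∘ ∈-converse⁺ ∘ p⊆q
    ; dom-covers = map₂ (∈-converse⁺ ∘ q˘⊆r ∘ ∈-converse⁺) ∘ n∈dom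
    ; ran-covers = map₂ ∈-converse⁺ ∘ n∈ran
    }

  module BackAndForth {F G : Subset} (extF : HasExtension adj F) (extG : HasExtension adj G) where

    chain : ℕ → ∃ (PartialIso F G)
    stage : ∀ n → Refinement F G (proj₁ (chain n)) n

    chain zero = [] , PartialIso-[]
    chain (suc n) = refined (stage n) , refined-iso (stage n)
    stage n = refine extF extG (proj₂ (chain n)) n

    P : ℕ → Pairs
    P n = proj₁ (chain n)

    ⊆-chain : ∀ {m n} → m ≤′ n → P m ⊆ₚ P n
    ⊆-chain ≤′-refl = id
    ⊆-chain (≤′-step m≤n) = ⊆-refined (stage _) ∘ ⊆-chain m≤n

    in-common-stage : ∀ {R : Set} {m n e e′} →
                      (∀ {q} → PartialIso F G q → e ∈ q → e′ ∈ q → R) → e ∈ P m → e′ ∈ P n → R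
    in-common-stage {m = m} {n} k e∈ e′∈ =
      k (proj₂ (chain (m + n))) (⊆-chain (m≤′m+n m n) e∈) (⊆-chain (n≤′m+n m n) e′∈)

    image-at : ∀ {x} → F x ≡ true → ∃ λ b → (x , b) ∈ P (suc x)
    image-at = dom-covers (stage _)

    preimage-at : ∀ {y} → G y ≡ true → ∃ λ a → (a , y) ∈ P (suc y)
    preimage-at = ran-covers (stage _)

    forward : Elem F → Elem G
    forward (x , Fx) = proj₁ (image-at Fx) , ran⊆ (refined-iso (stage x)) (proj₂ (image-at Fx))

    backward : Elem G → Elem F
    backward (y , Gy) = proj₁ (preimage-at Gy) , dom⊆ (refined-iso (stage y)) (proj₂ (preimage-at Gy))

    forward-backward : ∀ y → forward (backward y) ≡ y
    forward-backward (y , Gy) = Elem-≡ (in-common-stage {m = suc a} {n = suc y}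
      (λ i u v → functional i u v refl) (proj₂ (image-at Fa)) (proj₂ (preimage-at Gy)))
      where
      a = proj₁ (backward (y , Gy))
      Fa = proj₂ (backward (y , Gy))

    backward-forward : ∀ x → backward (forward x) ≡ x
    backward-forward (x , Fx) = Elem-≡ (in-common-stage {m = suc b} {n = suc x}
      (λ i u v → injective i u v refl) (proj₂ (preimage-at Gb)) (proj₂ (image-at Fx)))
      where
      b = proj₁ (forward (x , Fx))
      Gb = proj₂ (forward (x , Fx))

    isomorphism : Σ (Elem F ↔ Elem G) λ f →
                  ∀ x y → adj (proj₁ x) (proj₁ y) ≡ adj (proj₁ (Inverse.to f x)) (proj₁ (Inverse.to f y))
    isomorphism = mk↔ₛ′ forward backward forward-backward backward-forward ,
      λ { (x , Fx) (y , Fy) → in-common-stage {m = suc x} {n = suc y} (λ i → preserves-adj i)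
            (proj₂ (image-at Fx)) (proj₂ (image-at Fy)) }

  extension⇒edge : ∀ {F} → HasExtension adj full → HasExtension adj F → IsEdge adj F
  extension⇒edge extℕ extF =
    let f , f-adj = BackAndForth.isomorphism extF extℕ in Elem-full ↔-∘ f , f-adj

edge-∖ : ∀ {adj} → IsRado adj → ∀ {E} → IsEdge adj E → ∀ S → IsEdge adj (E ∖ S)
edge-∖ R e S = extension⇒edge (rado-extension R) (extension-∖ (edge-extension (rado-extension R) e) S)
  where
  open IsRado R
  open SimpleGraph _ symmetric irreflexive

module ClosedUnderFiniteRemoval (adj : Graph)
  (edge-∖ : ∀ {E} → IsEdge adj E → ∀ S → IsEdge adj (E ∖ S)) where

  PreservesOff : Perm → List ℕ → Set
  PreservesOff g S = ∀ E → IsEdge adj E → IsEdge adj (image g (E ∖ S))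

  FAut : Perm → Set
  FAut g = ∃ λ S → PreservesOff g S × PreservesOff (inv g) S

  module _ {g : Perm} where
    open Inverse g

    PreservesOff-mono : ∀ {S S′} → (∀ {v} → v ∈ S → v ∈ S′) →
                        PreservesOff g S → PreservesOff g S′
    PreservesOff-mono {S} {S′} S⊆S′ gS E e =
      IsEdge-resp-≐ (λ y → ∖-absorb {E ∖ S′} (∖-∈ {E} ∘ S⊆S′) (from y)) (gS (E ∖ S′) (edge-∖ e S′))

    PreservesOff-· : ∀ {h S T} → PreservesOff g S → PreservesOff h T →
                     PreservesOff (g · h) (S ++ map from T)
    PreservesOff-· {h} {S} {T} gS hT E e =
      IsEdge-resp-≐ (λ y → ∖-absorb {X} T-outside (Inverse.from h y))
                    (hT X (PreservesOff-mono ∈-++⁺ˡ gS E e))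
      where
      X = image g (E ∖ (S ++ map from T))
      T-outside : ∀ {v} → v ∈ T → X v ≡ false
      T-outside v∈T = ∖-∈ {E} (∈-++⁺ʳ S (∈-map⁺ from v∈T))

    PreservesOff-cong : ∀ {h S} → (∀ y → from y ≡ Inverse.from h y) →
                        PreservesOff g S → PreservesOff h S
    PreservesOff-cong {S = S} g≗h gS E e = IsEdge-resp-≐ (λ y → cong (E ∖ S) (g≗h y)) (gS E e)

    PreservesOff-support : ∀ {L} → (∀ v → v ∉ L → to v ≡ v) → (∀ v → v ∉ L → from v ≡ v) →
                           PreservesOff g L
    PreservesOff-support {L} to-fix from-fix E e = IsEdge-resp-≐ (λ y → sym (fixed y)) (edge-∖ e L)
      where
      fixed : ∀ y → (E ∖ L) (from y) ≡ (E ∖ L) y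
      fixed y = [ (λ y∈L → trans (∖-∈ {E} (from-∈ y∈L)) (sym (∖-∈ {E} y∈L)))
                , (λ y∉L → cong (E ∖ L) (from-fix y y∉L)) ]′ (toSum (y ∈? L))
        where
        from-∈ : y ∈ L → from y ∈ L
        from-∈ y∈L = [ id , (λ v∉L → contradiction (moved-back v∉L y∈L) v∉L) ]′ (toSum (from y ∈? L))
          where
          moved-back : from y ∉ L → y ∈ L → from y ∈ L
          moved-back v∉L = subst (_∈ L) (trans (sym (strictlyInverseˡ y)) (to-fix _ v∉L))

    aut⇒FAut : IsAutH adj g → FAut g
    aut⇒FAut aut = [] ,
      (λ E e → IsEdge-resp-≐ {adj} (λ y → sym (∖-[] {E} (from y))) (proj₁ (aut E) e)) ,
      (λ E e → IsEdge-resp-≐ {adj} (λ y → sym (∖-[] {E} (to y)))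
                 (proj₂ (aut (image (inv g) E))
                        (IsEdge-resp-≐ {adj} (λ y → cong E (sym (strictlyInverseˡ y))) e)))
      where
      ∖-[] : ∀ {E} → (E ∖ []) ≐ E
      ∖-[] {E} = ∖-absorb {E} {[]} (λ ())

  finitary⇒FAut : ∀ {g} → IsFinitary g → FAut g
  finitary⇒FAut {g} (L , to-fix) =
    L , PreservesOff-support {g} to-fix from-fix , PreservesOff-support {inv g} from-fix to-fix
    where
    open Inverse g
    from-fix : ∀ v → v ∉ L → from v ≡ v
    from-fix v v∉L = trans (cong from (sym (to-fix v v∉L))) (strictlyInverseʳ v)

  FAut-· : ∀ {g h} → FAut g → FAut h → FAut (g · h)
  FAut-· {g} {h} (S , gS , g⁻¹S) (T , hT , h⁻¹T) =
    U ++ U′ , PreservesOff-mono {g · h} {U} (∈-++⁺ˡ {ys = U′}) (PreservesOff-· {g} {h} gS hT) ,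
              PreservesOff-mono {inv (g · h)} {U′} (∈-++⁺ʳ U) (PreservesOff-· {inv h} {inv g} h⁻¹T g⁻¹S)
    where
    U = S ++ map (Inverse.from g) T
    U′ = T ++ map (Inverse.to h) S

  FAut-inv : ∀ {g} → FAut g → FAut (inv g)
  FAut-inv (S , gS , g⁻¹S) = S , g⁻¹S , gS

  FAut-resp-≈ₚ : ∀ {g h} → g ≈ₚ h → FAut g → FAut h
  FAut-resp-≈ₚ {g} {h} g≈h (S , gS , g⁻¹S) =
    S , PreservesOff-cong {g} {h} from-≈ gS , PreservesOff-cong {inv g} {inv h} g≈h g⁻¹S
    where
    from-≈ : ∀ y → Inverse.from g y ≡ Inverse.from h y
    from-≈ y = trans (sym (Inverse.strictlyInverseʳ h _))
                     (cong (Inverse.from h) (trans (sym (g≈h _)) (Inverse.strictlyInverseˡ g y)))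

  generated⇒FAut : ∀ {g} → Generated (AutOrFSym adj) g → FAut g
  generated⇒FAut {g} (gen (inj₁ aut)) = aut⇒FAut {g} aut
  generated⇒FAut {g} (gen (inj₂ fin)) = finitary⇒FAut {g} fin
  generated⇒FAut one = aut⇒FAut {idPerm} (λ _ → id , id)
  generated⇒FAut (mul {g} {h} dg dh) = FAut-· {g} {h} (generated⇒FAut dg) (generated⇒FAut dh)
  generated⇒FAut (inv' {g} dg) = FAut-inv {g} (generated⇒FAut dg)
  generated⇒FAut (ext {g} {h} dg g≈h) = FAut-resp-≈ₚ {g} {h} g≈h (generated⇒FAut dg)

mainTheorem8 : (adj : Graph) → IsRado adj →
    ∀ g → Generated (AutOrFSym adj) g → IsFAutH adj g
mainTheorem8 adj R g g∈⟨Aut∪FSym⟩ =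
  let S , gS , g⁻¹S = ClosedUnderFiniteRemoval.generated⇒FAut adj (edge-∖ R) g∈⟨Aut∪FSym⟩
  in S , λ E e → gS E e , g⁻¹S E e
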